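{- Let $f(x,y,z)=5x^2+7y^2+70z^2$ and let $n\in\mathbb{N}$. (i) If $n\equiv 1\pmod 4$, or $n\equiv 2\pmod 4$, or $n\equiv 4\pmod 8$, then $70n-2$ is represented by $f$ locally. (ii) If $n\equiv 3\pmod 4$ or $n\equiv 8\pmod{16}$, then $70n-32$ is represented by $f$ locally.
   Context: An integer $m$ is said to be represented by a quadratic form $f$ locally if $m$ is represented by $f$ over the real numbers $\mathbb{R}$ and over the ring $\mathbb{Z}_p$ of $p$-adic integers for every prime $p$ (i.e., $m$ is represented by the genus of $f$). -}

module Defs where

open import Data.Nat as ℕ using (ℕ; _^_)
open import Data.Nat.Primality using (Prime)
open import Data.Integer using (ℤ; +_; _+_; _*_; _-_; _≤_)
open import Data.Integer.Divisibility using (_∣_)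
open import Data.Product using (Σ; _×_)

f : ℤ → ℤ → ℤ → ℤ
f x y z = + 5 * (x * x) + + 7 * (y * y) + + 70 * (z * z)

-- The p-adic integers ℤ_p, modelled as the inverse limit lim ℤ/p^k:
-- a sequence of integers (x_k) with x_{k+1} ≡ x_k (mod p^k).
record ℤ[_] (p : ℕ) : Set where
  constructor padic
  field
    seq : ℕ → ℤ
    coh : ∀ k → (+ (p ^ k)) ∣ (seq (ℕ.suc k) - seq k)
open ℤ[_] public

RepZp : ℕ → ℤ → Set
RepZp p m = Σ (ℤ[ p ]) λ x → Σ (ℤ[ p ]) λ y → Σ (ℤ[ p ]) λ z →
  ∀ k → (+ (p ^ k)) ∣ (f (seq x k) (seq y k) (seq z k) - m)

-- m is represented by f over ℝ.  Since f is positive definite with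
-- real coefficients, this holds iff m ≥ 0.
RepR : ℤ → Set
RepR m = + 0 ≤ m

LocallyRep : ℤ → Set
LocallyRep m = RepR m × (∀ p → Prime p → RepZp p m)

{-# OPTIONS --safe #-}

-- Every p-adic representation comes from Hensel's lemma: a point v with f(v) ≡ m and a
-- coordinate along which the derivative of f is a unit lifts to a p-adic solution.
-- For p ∤ 70, pigeonhole on the p + 1 classes 5x² and m - 70z² - 7y² (0 ≤ x, y ≤ (p-1)/2)
-- solves 5x² + 7y² ≡ m - 70z² with x or y non-zero, z ∈ {0, 1} chosen so that the right-hand
-- side is a unit; so every integer is represented over ℤ_p.  Modulo 5 and 7 both 70n - 2 and
-- 70n - 32 are congruent to 7·2², 5·1² or 5·3².  Over ℤ₂ an odd coordinate can be lifted once
-- f(v) ≡ m mod 8 (mod 16 for z); for 70n - s this depends only on n mod 8 and is settled by a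
-- finite search, except for n ≡ 8 (mod 16), where 70n - 32 = 4²·(odd) and every odd integer is
-- 2-adically represented.  Over ℝ it only remains that 70n - s ≥ 0 for n ≥ 1.

module Submission where

open import Defs
open import Data.Nat as ℕ using (ℕ; zero; suc; _%_; _/_; z≤n; s≤s)
import Data.Nat.Properties as ℕ
open import Data.Nat.DivMod using (m%n<n; m%n%n≡m%n; m∣n⇒o%n%m≡o%m; m≡m%n+[m/n]*n)
import Data.Nat.Divisibility as ℕ∣
open import Data.Nat.Primality using (Prime; prime[2]; prime?; prime⇒irreducible; prime⇒nonZero; euclidsLemma)
open import Data.Nat.Coprimality using (Coprime; coprime-Bézout)
open import Data.Nat.GCD using (module Bézout)
open import Data.Integer as ℤ using (ℤ; +_; -_; _+_; _*_; _-_; _≤_; +≤+)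
open import Data.Integer.Properties
  using (pos-*; pos-+; abs-*; m-n≡m⊖n; ⊖-≥; +∣i∣≡i⊎+∣i∣≡-i; +-injective; ∣i-j∣≤∣i∣+∣j∣; ∣i∣≡0⇒i≡0; i-j≡0⇒i≡j;
         *-comm; *-identityˡ; +-identityʳ)
open import Data.Integer.DivMod using (_%ℕ_; _/ℕ_; n%ℕd<d; a≡a%ℕn+[a/ℕn]*n)
open import Data.Integer.Divisibility.Signed
  using (_∣_; divides; _∣?_; ∣ᵤ⇒∣; ∣⇒∣ᵤ; ∣-refl; ∣-trans; ∣m∣n⇒∣m+n; ∣m∣n⇒∣m-n; ∣m⇒∣-m; ∣n⇒∣m*n; ∣m⇒∣m*n; *-monoʳ-∣; *-monoˡ-∣)
open import Data.Integer.Tactic.RingSolver using (solve-∀)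
open import Data.Fin as Fin using (Fin; toℕ; fromℕ<; splitAt; join)
open import Data.Fin.Properties
  using (any?; pigeonhole; toℕ-fromℕ<; toℕ-injective; toℕ≤pred[n]; join-splitAt; <⇒≢)
open import Data.Product using (Σ; Σ-syntax; ∃-syntax; ∃₂; _×_; _,_; proj₁)
open import Data.Sum using (_⊎_; inj₁; inj₂; [_,_]′)
import Data.Sum as Sum
open import Function using (_∘_)
open import Relation.Nullary using (Dec; yes; no; ¬_; ¬?; contradiction)
open import Relation.Nullary.Decidable using (_×-dec_; _⊎-dec_; _→-dec_; from-yes; from-no)
open import Relation.Binary.PropositionalEquality
  using (_≡_; _≢_; refl; sym; trans; cong; cong₂; subst; subst₂; module ≡-Reasoning)

open ≡-Reasoning

∣-product : ∀ {i j m n} → i ∣ m → j ∣ n → i * j ∣ m * n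
∣-product {i} {n = n} i∣m j∣n = ∣-trans (*-monoʳ-∣ i j∣n) (*-monoˡ-∣ n i∣m)

∣-diff-trans : ∀ {d a c m} → d ∣ a - c → d ∣ m - c → d ∣ a - m
∣-diff-trans {a = a} {c} {m} d∣a-c d∣m-c = subst (_ ∣_) (identity a c m) (∣m∣n⇒∣m-n d∣a-c d∣m-c)
  where
  identity : ∀ a c m → (a - c) - (m - c) ≡ a - m
  identity = solve-∀

∣∧∣i∣<⇒≡0 : ∀ {p i} → + p ∣ i → ℤ.∣ i ∣ ℕ.< p → i ≡ + 0
∣∧∣i∣<⇒≡0 {p} {i} p∣i ∣i∣<p = ∣i∣≡0⇒i≡0 (below (∣⇒∣ᵤ p∣i) ∣i∣<p)
  where
  below : ∀ {n} → p ℕ∣.∣ n → n ℕ.< p → n ≡ 0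
  below {zero}  _   _   = refl
  below {suc n} p∣n n<p = contradiction p∣n (ℕ∣.>⇒∤ n<p)

prime∣prime : ∀ {p q} → Prime p → Prime q → p ℕ∣.∣ q → p ≡ q
prime∣prime pp pq p∣q with prime⇒irreducible pq p∣q
... | inj₁ refl = contradiction pp λ ()
... | inj₂ p≡q  = p≡q

euclidsLemmaℤ : ∀ {p} i j → Prime p → + p ∣ i * j → + p ∣ i ⊎ + p ∣ j
euclidsLemmaℤ {p} i j pp p∣ij =
  Sum.map ∣ᵤ⇒∣ ∣ᵤ⇒∣ (euclidsLemma ℤ.∣ i ∣ ℤ.∣ j ∣ pp (subst (p ℕ∣.∣_) (abs-* i j) (∣⇒∣ᵤ p∣ij)))

prime∤* : ∀ {p i j} → Prime p → ¬ + p ∣ i → ¬ + p ∣ j → ¬ + p ∣ i * j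
prime∤* {i = i} {j} pp p∤i p∤j = [ p∤i , p∤j ]′ ∘ euclidsLemmaℤ i j pp

pos-linear : ∀ a b c → + (a ℕ.+ b ℕ.* c) ≡ + a + + b * + c
pos-linear a b c = trans (pos-+ a (b ℕ.* c)) (cong (_+_ (+ a)) (pos-* b c))

prime∤⇒coprime : ∀ {p n} → Prime p → ¬ p ℕ∣.∣ n → Coprime p n
prime∤⇒coprime pp p∤n (d∣p , d∣n) with prime⇒irreducible pp d∣p
... | inj₁ d≡1 = d≡1
... | inj₂ refl = contradiction d∣n p∤n

coprime⇒invertible : ∀ {p n} → Coprime p n → ∃[ w ] + p ∣ + 1 - w * + n
coprime⇒invertible {p} {n} coprime with coprime-Bézout coprime
... | Bézout.+- x y eq = - + y , divides (+ x) (begin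
  + 1 - - + y * + n     ≡⟨ identity (+ y) (+ n) ⟩
  + 1 + + y * + n       ≡⟨ pos-linear 1 y n ⟨
  + (1 ℕ.+ y ℕ.* n)     ≡⟨ cong +_ eq ⟩
  + (x ℕ.* p)           ≡⟨ pos-* x p ⟩
  + x * + p             ∎)
  where
  identity : ∀ y n → + 1 - - y * n ≡ + 1 + y * n
  identity = solve-∀
... | Bézout.-+ x y eq = + y , divides (- + x) (begin
  + 1 - + y * + n         ≡⟨ cong (λ v → + 1 - v) (pos-* y n) ⟨
  + 1 - + (y ℕ.* n)       ≡⟨ cong (λ v → + 1 - + v) eq ⟨
  + 1 - + (1 ℕ.+ x ℕ.* p) ≡⟨ cong (λ v → + 1 - v) (pos-linear 1 x p) ⟩
  + 1 - (+ 1 + + x * + p) ≡⟨ identity (+ x) (+ p) ⟩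
  - + x * + p             ∎)
  where
  identity : ∀ x p → + 1 - (+ 1 + x * p) ≡ - x * p
  identity = solve-∀

invertible-mod-prime : ∀ {p b} → Prime p → ¬ + p ∣ b → ∃[ w ] + p ∣ + 1 - w * b
invertible-mod-prime {p} {b} pp p∤b with coprime⇒invertible (prime∤⇒coprime pp (p∤b ∘ ∣ᵤ⇒∣)) | +∣i∣≡i⊎+∣i∣≡-i b
... | w , p∣1-w∣b∣ | inj₁ ∣b∣≡b  = w , subst (λ v → + p ∣ + 1 - w * v) ∣b∣≡b p∣1-w∣b∣
... | w , p∣1-w∣b∣ | inj₂ ∣b∣≡-b = - w , subst (+ p ∣_) (trans (cong (λ v → + 1 - w * v) ∣b∣≡-b) (identity w b)) p∣1-w∣b∣
  where
  identity : ∀ w b → + 1 - w * - b ≡ + 1 - - w * b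
  identity = solve-∀

-- Hensel's lemma for quadratic polynomials

quadratic : ℤ → ℤ → ℤ → ℤ → ℤ
quadratic A B C t = A + B * t + C * (t * t)

pᵏ∣pᵏ⁺¹ : ∀ p k → + (p ℕ.^ k) ∣ + (p ℕ.^ suc k)
pᵏ∣pᵏ⁺¹ p k = divides (+ p) (pos-* p (p ℕ.^ k))

p∣pᵏ⁺¹ : ∀ p k → + p ∣ + (p ℕ.^ suc k)
p∣pᵏ⁺¹ p k = divides (+ (p ℕ.^ k)) (trans (pos-* p (p ℕ.^ k)) (*-comm (+ p) _))

-- Newton's method t ↦ t - w h(t) with w a fixed inverse of h′(0) mod p: w stays an inverse of
-- h′(t) mod p (p ∣ defect t), and h gains a factor p at every step.
module Newton (A B C w : ℤ) where

  h : ℤ → ℤ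
  h = quadratic A B C

  defect : ℤ → ℤ
  defect t = + 1 - w * (B + + 2 * C * t)

  step : ℤ → ℤ
  step t = t - w * h t

  approx : ℕ → ℤ
  approx zero    = + 0
  approx (suc k) = step (approx k)

  h-step : ∀ t → h (step t) ≡ defect t * h t + C * w * w * (h t * h t)
  h-step t = identity A B C w t
    where
    identity : ∀ A B C w t →
      let H = A + B * t + C * (t * t) in
      A + B * (t - w * H) + C * ((t - w * H) * (t - w * H))
        ≡ (+ 1 - w * (B + + 2 * C * t)) * H + C * w * w * (H * H)
    identity = solve-∀

  defect-step : ∀ t → defect (step t) ≡ defect t + + 2 * C * w * w * h t
  defect-step t = identity B C w t (h t)
    where
    identity : ∀ B C w t H →
      + 1 - w * (B + + 2 * C * (t - w * H)) ≡ (+ 1 - w * (B + + 2 * C * t)) + + 2 * C * w * w * H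
    identity = solve-∀

  module _ {p : ℕ} (p∣A : + p ∣ A) (p∣1-wB : + p ∣ + 1 - w * B) where

    approx-invariant : ∀ k → + (p ℕ.^ suc k) ∣ h (approx k) × + p ∣ defect (approx k)
    approx-invariant zero = subst₂ _∣_ (cong +_ (sym (ℕ.*-identityʳ p))) (sym (h-zero A B C)) p∣A
                          , subst (+ p ∣_) (sym (defect-zero B C w)) p∣1-wB
      where
      h-zero : ∀ A B C → A + B * + 0 + C * (+ 0 * + 0) ≡ A
      h-zero = solve-∀
      defect-zero : ∀ B C w → + 1 - w * (B + + 2 * C * + 0) ≡ + 1 - w * B
      defect-zero = solve-∀
    approx-invariant (suc k) with pᵏ⁺¹∣h , p∣defect ← approx-invariant k =
      subst₂ _∣_ (sym (pos-* p _)) (sym (h-step t))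
        (∣m∣n⇒∣m+n (∣-product p∣defect pᵏ⁺¹∣h) (∣n⇒∣m*n (C * w * w) (∣-product p∣h pᵏ⁺¹∣h))) ,
      subst (+ p ∣_) (sym (defect-step t)) (∣m∣n⇒∣m+n p∣defect (∣n⇒∣m*n (+ 2 * C * w * w) p∣h))
      where
      t = approx k
      p∣h : + p ∣ h t
      p∣h = ∣-trans (p∣pᵏ⁺¹ p k) pᵏ⁺¹∣h

hensel : ∀ {p} A B C w → + p ∣ A → + p ∣ + 1 - w * B →
         Σ ℤ[ p ] λ t → ∀ k → + (p ℕ.^ k) ∣ quadratic A B C (seq t k)
hensel {p} A B C w p∣A p∣1-wB =
  padic approx (λ k → ∣⇒∣ᵤ (subst (+ (p ℕ.^ k) ∣_) (step-diff (approx k)) (∣m⇒∣-m (∣n⇒∣m*n w (pᵏ∣h k))))) , pᵏ∣h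
  where
  open Newton A B C w
  pᵏ∣h : ∀ k → + (p ℕ.^ k) ∣ h (approx k)
  pᵏ∣h k = ∣-trans (pᵏ∣pᵏ⁺¹ p k) (proj₁ (approx-invariant p∣A p∣1-wB k))
  step-diff : ∀ t → - (w * h t) ≡ step t - t
  step-diff t = identity t w (h t)
    where
    identity : ∀ t w H → - (w * H) ≡ (t - w * H) - t
    identity = solve-∀

-- Lifting a representation along a line

affine : ∀ {p} → ℤ → ℤ → ℤ[ p ] → ℤ[ p ]
affine {p} x a t = padic (λ k → x + a * seq t k)
  (λ k → ∣⇒∣ᵤ (subst (+ (p ℕ.^ k) ∣_) (identity x a (seq t (suc k)) (seq t k)) (∣n⇒∣m*n a (∣ᵤ⇒∣ (coh t k)))))
  where
  identity : ∀ x a s′ s → a * (s′ - s) ≡ (x + a * s′) - (x + a * s)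
  identity = solve-∀

-- f(v + d) - f(v) - f(d)
f-polar : ℤ → ℤ → ℤ → ℤ → ℤ → ℤ → ℤ
f-polar x y z a b c = + 10 * x * a + + 14 * y * b + + 140 * z * c

f-along-line : ∀ x y z a b c t →
  f (x + a * t) (y + b * t) (z + c * t) ≡ f x y z + f-polar x y z a b c * t + f a b c * (t * t)
f-along-line = identity
  where
  identity : ∀ x y z a b c t →
    + 5 * ((x + a * t) * (x + a * t)) + + 7 * ((y + b * t) * (y + b * t)) + + 70 * ((z + c * t) * (z + c * t))
      ≡ + 5 * (x * x) + + 7 * (y * y) + + 70 * (z * z) + (+ 10 * x * a + + 14 * y * b + + 140 * z * c) * t
        + (+ 5 * (a * a) + + 7 * (b * b) + + 70 * (c * c)) * (t * t)
  identity = solve-∀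

f-on-line≡quadratic : ∀ {x y z m} (a b c D A B C : ℤ) →
  f x y z - m ≡ D * A → f-polar x y z a b c ≡ D * B → f a b c ≡ D * C →
  ∀ t → f (x + a * t) (y + b * t) (z + c * t) - m ≡ D * quadratic A B C t
f-on-line≡quadratic {x} {y} {z} {m} a b c D A B C f≡DA polar≡DB f≡DC t = begin
    f (x + a * t) (y + b * t) (z + c * t) - m                    ≡⟨ cong (_- m) (f-along-line x y z a b c t) ⟩
    f x y z + f-polar x y z a b c * t + f a b c * (t * t) - m    ≡⟨ regroup (f x y z) (f-polar x y z a b c) (f a b c) m t ⟩
    (f x y z - m) + f-polar x y z a b c * t + f a b c * (t * t)  ≡⟨ cong₂ (λ u v → u + v * t + f a b c * (t * t)) f≡DA polar≡DB ⟩
    D * A + D * B * t + f a b c * (t * t)                        ≡⟨ cong (λ u → D * A + D * B * t + u * (t * t)) f≡DC ⟩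
    D * A + D * B * t + D * C * (t * t)                          ≡⟨ factor D A B C t ⟩
    D * quadratic A B C t                                        ∎
    where
    regroup : ∀ F P Q m t → F + P * t + Q * (t * t) - m ≡ (F - m) + P * t + Q * (t * t)
    regroup = solve-∀
    factor : ∀ D A B C t → D * A + D * B * t + D * C * (t * t) ≡ D * (A + B * t + C * (t * t))
    factor = solve-∀

repZp-from-line-root : ∀ {p x y z m} (a b c D A B C : ℤ) →
  (∀ t → f (x + a * t) (y + b * t) (z + c * t) - m ≡ D * quadratic A B C t) →
  (Σ ℤ[ p ] λ t → ∀ k → + (p ℕ.^ k) ∣ quadratic A B C (seq t k)) → RepZp p m
repZp-from-line-root {p} {x} {y} {z} {m} a b c D A B C on-line (t , root) =
  affine x a t , affine y b t , affine z c t , λ k → ∣⇒∣ᵤ (p∣ k)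
  where
  p∣ : ∀ k → + (p ℕ.^ k) ∣ f (x + a * seq t k) (y + b * seq t k) (z + c * seq t k) - m
  p∣ k = subst (+ (p ℕ.^ k) ∣_) (sym (on-line (seq t k))) (∣n⇒∣m*n D (root k))

repZp-along : ∀ {p x y z m} → Prime p → (a b c D A B C : ℤ) →
  f x y z - m ≡ D * A → f-polar x y z a b c ≡ D * B → f a b c ≡ D * C →
  + p ∣ A → ¬ + p ∣ B → RepZp p m
repZp-along {x = x} {y} {z} {m} pp a b c D A B C f≡DA polar≡DB f≡DC p∣A p∤B =
  let w , p∣1-wB = invertible-mod-prime pp p∤B in
  repZp-from-line-root {x = x} {y} {z} {m} a b c D A B C
    (f-on-line≡quadratic {x = x} {y} {z} {m} a b c D A B C f≡DA polar≡DB f≡DC)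
    (hensel A B C w p∣A p∣1-wB)

repZp-lift-x : ∀ {p x y z m} → Prime p → + p ∣ f x y z - m → ¬ + p ∣ + 10 * x → RepZp p m
repZp-lift-x {x = x} {y} {z} {m} pp p∣f-m p∤10x =
  repZp-along {x = x} {y} {z} {m} pp (+ 1) (+ 0) (+ 0) (+ 1) (f x y z - m) (+ 10 * x) (+ 5)
    (sym (*-identityˡ _)) (polar x y z) refl p∣f-m p∤10x
  where
  polar : ∀ x y z → + 10 * x * + 1 + + 14 * y * + 0 + + 140 * z * + 0 ≡ + 1 * (+ 10 * x)
  polar = solve-∀

repZp-lift-y : ∀ {p x y z m} → Prime p → + p ∣ f x y z - m → ¬ + p ∣ + 14 * y → RepZp p m
repZp-lift-y {x = x} {y} {z} {m} pp p∣f-m p∤14y =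
  repZp-along {x = x} {y} {z} {m} pp (+ 0) (+ 1) (+ 0) (+ 1) (f x y z - m) (+ 14 * y) (+ 7)
    (sym (*-identityˡ _)) (polar x y z) refl p∣f-m p∤14y
  where
  polar : ∀ x y z → + 10 * x * + 0 + + 14 * y * + 1 + + 140 * z * + 0 ≡ + 1 * (+ 14 * y)
  polar = solve-∀

repZp-scale : ∀ {p m} k → RepZp p m → RepZp p (k * k * m)
repZp-scale {p} {m} k (x , y , z , rep) =
  affine (+ 0) k x , affine (+ 0) k y , affine (+ 0) k z ,
  λ i → ∣⇒∣ᵤ (subst (+ (p ℕ.^ i) ∣_) (identity k (seq x i) (seq y i) (seq z i) m) (∣n⇒∣m*n (k * k) (∣ᵤ⇒∣ (rep i))))
  where
  identity : ∀ k x y z m →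
    k * k * (+ 5 * (x * x) + + 7 * (y * y) + + 70 * (z * z) - m)
      ≡ + 5 * ((+ 0 + k * x) * (+ 0 + k * x)) + + 7 * ((+ 0 + k * y) * (+ 0 + k * y))
        + + 70 * ((+ 0 + k * z) * (+ 0 + k * z)) - k * k * m
  identity = solve-∀

-- Representations over ℤ₂

-- Over ℤ₂ the polar form is even; stepping by 2 and dividing out 4 (8 along z) leaves a
-- quadratic with odd linear coefficient, and even constant term when 8 ∣ f - m (16 ∣ f - m).
repZp₂-lift-x : ∀ {x y z m} → ¬ + 2 ∣ x → + 8 ∣ f x y z - m → RepZp 2 m
repZp₂-lift-x {x} {y} {z} {m} 2∤x (divides q f-m≡8q) =
  repZp-along {x = x} {y} {z} {m} prime[2] (+ 2) (+ 0) (+ 0) (+ 4) (+ 2 * q) (+ 5 * x) (+ 5)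
    (trans f-m≡8q (regroup q)) (polar x y z) refl (divides q (*-comm (+ 2) q))
    (prime∤* prime[2] (from-no (+ 2 ∣? + 5)) 2∤x)
  where
  regroup : ∀ q → q * + 8 ≡ + 4 * (+ 2 * q)
  regroup = solve-∀
  polar : ∀ x y z → + 10 * x * + 2 + + 14 * y * + 0 + + 140 * z * + 0 ≡ + 4 * (+ 5 * x)
  polar = solve-∀

repZp₂-lift-y : ∀ {x y z m} → ¬ + 2 ∣ y → + 8 ∣ f x y z - m → RepZp 2 m
repZp₂-lift-y {x} {y} {z} {m} 2∤y (divides q f-m≡8q) =
  repZp-along {x = x} {y} {z} {m} prime[2] (+ 0) (+ 2) (+ 0) (+ 4) (+ 2 * q) (+ 7 * y) (+ 7)
    (trans f-m≡8q (regroup q)) (polar x y z) refl (divides q (*-comm (+ 2) q))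
    (prime∤* prime[2] (from-no (+ 2 ∣? + 7)) 2∤y)
  where
  regroup : ∀ q → q * + 8 ≡ + 4 * (+ 2 * q)
  regroup = solve-∀
  polar : ∀ x y z → + 10 * x * + 0 + + 14 * y * + 2 + + 140 * z * + 0 ≡ + 4 * (+ 7 * y)
  polar = solve-∀

repZp₂-lift-z : ∀ {x y z m} → ¬ + 2 ∣ z → + 16 ∣ f x y z - m → RepZp 2 m
repZp₂-lift-z {x} {y} {z} {m} 2∤z (divides q f-m≡16q) =
  repZp-along {x = x} {y} {z} {m} prime[2] (+ 0) (+ 0) (+ 2) (+ 8) (+ 2 * q) (+ 35 * z) (+ 35)
    (trans f-m≡16q (regroup q)) (polar x y z) refl (divides q (*-comm (+ 2) q))
    (prime∤* prime[2] (from-no (+ 2 ∣? + 35)) 2∤z)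
  where
  regroup : ∀ q → q * + 16 ≡ + 8 * (+ 2 * q)
  regroup = solve-∀
  polar : ∀ x y z → + 10 * x * + 0 + + 14 * y * + 0 + + 140 * z * + 2 ≡ + 8 * (+ 35 * z)
  polar = solve-∀

Liftable₂ : ℤ → ℤ → ℤ → ℤ → Set
Liftable₂ x y z c = (¬ + 2 ∣ x × + 8 ∣ f x y z - c)
                  ⊎ (¬ + 2 ∣ y × + 8 ∣ f x y z - c)
                  ⊎ (¬ + 2 ∣ z × + 16 ∣ f x y z - c)

liftable₂? : ∀ x y z c → Dec (Liftable₂ x y z c)
liftable₂? x y z c = (¬? (+ 2 ∣? x) ×-dec + 8 ∣? f x y z - c)
               ⊎-dec (¬? (+ 2 ∣? y) ×-dec + 8 ∣? f x y z - c)
               ⊎-dec (¬? (+ 2 ∣? z) ×-dec + 16 ∣? f x y z - c)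

repZp₂-liftable : ∀ {x y z c m} → Liftable₂ x y z c → + 16 ∣ m - c → RepZp 2 m
repZp₂-liftable {x} {y} {z} {c} {m} (inj₁ (2∤x , 8∣f-c)) 16∣m-c =
  repZp₂-lift-x {x} {y} {z} {m} 2∤x (∣-diff-trans {a = f x y z} {c} 8∣f-c (∣-trans (divides (+ 2) refl) 16∣m-c))
repZp₂-liftable {x} {y} {z} {c} {m} (inj₂ (inj₁ (2∤y , 8∣f-c))) 16∣m-c =
  repZp₂-lift-y {x} {y} {z} {m} 2∤y (∣-diff-trans {a = f x y z} {c} 8∣f-c (∣-trans (divides (+ 2) refl) 16∣m-c))
repZp₂-liftable {x} {y} {z} {c} {m} (inj₂ (inj₂ (2∤z , 16∣f-c))) 16∣m-c =
  repZp₂-lift-z {x} {y} {z} {m} 2∤z (∣-diff-trans {a = f x y z} {c} 16∣f-c 16∣m-c)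

-- Searching coordinates in {0, 1, 2, 3} makes the existence of a witness decidable.
HasLiftable₂ : ℤ → Set
HasLiftable₂ c = Σ[ x ∈ Fin 4 ] Σ[ y ∈ Fin 4 ] Σ[ z ∈ Fin 4 ] Liftable₂ (+ toℕ x) (+ toℕ y) (+ toℕ z) c

hasLiftable₂? : ∀ c → Dec (HasLiftable₂ c)
hasLiftable₂? c = any? λ x → any? λ y → any? λ z → liftable₂? (+ toℕ x) (+ toℕ y) (+ toℕ z) c

repZp₂-by-residue : ∀ a b → + 16 ∣ a * + 8 → ∀ n → HasLiftable₂ (a * + (n %ℕ 8) + b) → RepZp 2 (a * n + b)
repZp₂-by-residue a b 16∣8a n (_ , _ , _ , liftable) =
  repZp₂-liftable liftable (subst (+ 16 ∣_) (sym congruence) (∣n⇒∣m*n (n /ℕ 8) 16∣8a))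
  where
  congruence : (a * n + b) - (a * + (n %ℕ 8) + b) ≡ n /ℕ 8 * (a * + 8)
  congruence = begin
    (a * n + b) - (a * + (n %ℕ 8) + b)
      ≡⟨ cong (λ n′ → (a * n′ + b) - (a * + (n %ℕ 8) + b)) (a≡a%ℕn+[a/ℕn]*n n 8) ⟩
    (a * (+ (n %ℕ 8) + n /ℕ 8 * + 8) + b) - (a * + (n %ℕ 8) + b)
      ≡⟨ identity a b (+ (n %ℕ 8)) (n /ℕ 8) ⟩
    n /ℕ 8 * (a * + 8) ∎
    where
    identity : ∀ a b r q → (a * (r + q * + 8) + b) - (a * r + b) ≡ q * (a * + 8)
    identity = solve-∀

repZp₂-odd : ∀ j → RepZp 2 (+ 2 * j + + 1)
repZp₂-odd j = repZp₂-by-residue (+ 2) (+ 1) ∣-refl j (residues (n%ℕd<d j 8))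
  where
  residues : ∀ {r} → r ℕ.< 8 → HasLiftable₂ (+ 2 * + r + + 1)
  residues = from-yes (ℕ.allUpTo? (λ r → hasLiftable₂? (+ 2 * + r + + 1)) 8)

n%8%4≡n%4 : ∀ n → n % 8 % 4 ≡ n % 4
n%8%4≡n%4 n = m∣n⇒o%n%m≡o%m 4 8 n (ℕ∣.divides 2 refl)

repZp₂-70n-2 : ∀ n → n % 4 ≡ 1 ⊎ n % 4 ≡ 2 ⊎ n % 8 ≡ 4 → RepZp 2 (+ 70 * + n - + 2)
repZp₂-70n-2 n class =
  repZp₂-by-residue (+ 70) (- + 2) (divides (+ 35) refl) (+ n) (residues (m%n<n n 8) class′)
  where
  residues : ∀ {r} → r ℕ.< 8 → r % 4 ≡ 1 ⊎ r % 4 ≡ 2 ⊎ r % 8 ≡ 4 → HasLiftable₂ (+ 70 * + r - + 2)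
  residues = from-yes (ℕ.allUpTo? (λ r →
    ((r % 4 ℕ.≟ 1) ⊎-dec (r % 4 ℕ.≟ 2) ⊎-dec (r % 8 ℕ.≟ 4)) →-dec hasLiftable₂? (+ 70 * + r - + 2)) 8)
  class′ : n % 8 % 4 ≡ 1 ⊎ n % 8 % 4 ≡ 2 ⊎ n % 8 % 8 ≡ 4
  class′ = Sum.map (trans (n%8%4≡n%4 n)) (Sum.map (trans (n%8%4≡n%4 n)) (trans (m%n%n≡m%n n 8))) class

repZp₂-70n-32 : ∀ n → n % 4 ≡ 3 ⊎ n % 16 ≡ 8 → RepZp 2 (+ 70 * + n - + 32)
repZp₂-70n-32 n (inj₁ n≡3) =
  repZp₂-by-residue (+ 70) (- + 32) (divides (+ 35) refl) (+ n) (residues (m%n<n n 8) (trans (n%8%4≡n%4 n) n≡3))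
  where
  residues : ∀ {r} → r ℕ.< 8 → r % 4 ≡ 3 → HasLiftable₂ (+ 70 * + r - + 32)
  residues = from-yes (ℕ.allUpTo? (λ r → (r % 4 ℕ.≟ 3) →-dec hasLiftable₂? (+ 70 * + r - + 32)) 8)
repZp₂-70n-32 n (inj₂ n≡8) =
  subst (RepZp 2) (sym factorisation) (repZp-scale (+ 4) (repZp₂-odd (+ 16 + + 35 * q)))
  where
  q = + n /ℕ 16
  factorisation : + 70 * + n - + 32 ≡ + 4 * + 4 * (+ 2 * (+ 16 + + 35 * q) + + 1)
  factorisation = begin
    + 70 * + n - + 32                        ≡⟨ cong (λ n′ → + 70 * n′ - + 32) (a≡a%ℕn+[a/ℕn]*n (+ n) 16) ⟩
    + 70 * (+ (n % 16) + q * + 16) - + 32    ≡⟨ cong (λ r → + 70 * (+ r + q * + 16) - + 32) n≡8 ⟩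
    + 70 * (+ 8 + q * + 16) - + 32           ≡⟨ identity q ⟩
    + 4 * + 4 * (+ 2 * (+ 16 + + 35 * q) + + 1) ∎
    where
    identity : ∀ q → + 70 * (+ 8 + q * + 16) - + 32 ≡ + 4 * + 4 * (+ 2 * (+ 16 + + 35 * q) + + 1)
    identity = solve-∀

-- Primes not dividing 70

module _ {p : ℕ} .{{_ : ℕ.NonZero p}} where

  residue : ℤ → Fin p
  residue i = fromℕ< (n%ℕd<d i p)

  residue-≡⇒∣ : ∀ i j → residue i ≡ residue j → + p ∣ i - j
  residue-≡⇒∣ i j same = divides (i /ℕ p - j /ℕ p) (begin
    i - j                                           ≡⟨ cong₂ _-_ (a≡a%ℕn+[a/ℕn]*n i p) (a≡a%ℕn+[a/ℕn]*n j p) ⟩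
    (+ (i %ℕ p) + i /ℕ p * + p) - (+ (j %ℕ p) + j /ℕ p * + p)
      ≡⟨ cong (λ r → (+ (i %ℕ p) + i /ℕ p * + p) - (+ r + j /ℕ p * + p)) (sym same-remainder) ⟩
    (+ (i %ℕ p) + i /ℕ p * + p) - (+ (i %ℕ p) + j /ℕ p * + p) ≡⟨ identity (+ (i %ℕ p)) (i /ℕ p) (j /ℕ p) (+ p) ⟩
    (i /ℕ p - j /ℕ p) * + p                         ∎)
    where
    same-remainder : i %ℕ p ≡ j %ℕ p
    same-remainder = trans (sym (toℕ-fromℕ< _)) (trans (cong toℕ same) (toℕ-fromℕ< _))
    identity : ∀ r a b p → (r + a * p) - (r + b * p) ≡ (a - b) * p
    identity = solve-∀

square-residues-distinct : ∀ {p h a x y} → Prime p → h ℕ.+ h ℕ.< p → ¬ + p ∣ a → x ℕ.≤ h → y ℕ.≤ h →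
  + p ∣ a * (+ x * + x) - a * (+ y * + y) → x ≡ y
square-residues-distinct {p} {h} {a} {x} {y} pp 2h<p p∤a x≤h y≤h p∣ax²-ay² =
  [ (λ p∣a → contradiction p∣a p∤a) , [ from-difference , from-sum ]′ ∘ euclidsLemmaℤ _ _ pp ]′
    (euclidsLemmaℤ a _ pp (subst (+ p ∣_) (factor a (+ x) (+ y)) p∣ax²-ay²))
  where
  factor : ∀ a x y → a * (x * x) - a * (y * y) ≡ a * ((x - y) * (x + y))
  factor = solve-∀
  x+y<p : x ℕ.+ y ℕ.< p
  x+y<p = ℕ.≤-<-trans (ℕ.+-mono-≤ x≤h y≤h) 2h<p
  from-difference : + p ∣ + x - + y → x ≡ y
  from-difference p∣x-y = +-injective (i-j≡0⇒i≡j (+ x) (+ y)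
    (∣∧∣i∣<⇒≡0 p∣x-y (ℕ.≤-<-trans (∣i-j∣≤∣i∣+∣j∣ (+ x) (+ y)) x+y<p)))
  from-sum : + p ∣ + x + + y → x ≡ y
  from-sum p∣x+y = trans (ℕ.m+n≡0⇒m≡0 x x+y≡0) (sym (ℕ.m+n≡0⇒n≡0 x x+y≡0))
    where
    x+y≡0 : x ℕ.+ y ≡ 0
    x+y≡0 = +-injective (∣∧∣i∣<⇒≡0 p∣x+y x+y<p)

-- Pigeonhole: the p + 1 values a x² and c - b y² (0 ≤ x, y ≤ h) cannot be pairwise distinct mod p.
two-squares-mod : ∀ {p h a b} → Prime p → p ≡ suc (h ℕ.+ h) → ¬ + p ∣ a → ¬ + p ∣ b → ∀ c →
  ∃₂ λ x y → x ℕ.< p × y ℕ.< p × + p ∣ a * (+ x * + x) + b * (+ y * + y) - c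
two-squares-mod {p} {h} {a} {b} pp p≡1+2h p∤a p∤b c = use-collision (pigeonhole p<2[1+h] (value ∘ splitAt (suc h)))
  where
  instance _ = prime⇒nonZero pp

  Solution : Set
  Solution = ∃₂ λ x y → x ℕ.< p × y ℕ.< p × + p ∣ a * (+ x * + x) + b * (+ y * + y) - c

  2h<p : h ℕ.+ h ℕ.< p
  2h<p = subst (h ℕ.+ h ℕ.<_) (sym p≡1+2h) (ℕ.n<1+n _)

  p<2[1+h] : p ℕ.< suc h ℕ.+ suc h
  p<2[1+h] = subst (ℕ._< suc h ℕ.+ suc h) (sym p≡1+2h) (s≤s (ℕ.+-monoʳ-< h (ℕ.n<1+n h)))

  toℕ<p : (x : Fin (suc h)) → toℕ x ℕ.< p
  toℕ<p x = ℕ.≤-<-trans (toℕ≤pred[n] x) (ℕ.≤-<-trans (ℕ.m≤m+n h h) 2h<p)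

  sq : Fin (suc h) → ℤ
  sq x = + toℕ x * + toℕ x

  value : Fin (suc h) ⊎ Fin (suc h) → Fin p
  value = [ (λ x → residue (a * sq x)) , (λ y → residue (c - b * sq y)) ]′

  splitAt-≢ : ∀ {i j} → i Fin.< j → splitAt (suc h) i ≢ splitAt (suc h) j
  splitAt-≢ {i} {j} i<j eq = <⇒≢ i<j (begin
    i                                   ≡⟨ join-splitAt (suc h) (suc h) i ⟨
    join (suc h) (suc h) (splitAt (suc h) i) ≡⟨ cong (join (suc h) (suc h)) eq ⟩
    join (suc h) (suc h) (splitAt (suc h) j) ≡⟨ join-splitAt (suc h) (suc h) j ⟩
    j                                   ∎)

  collision : ∀ u v → u ≢ v → value u ≡ value v → Solution
  collision (inj₁ x) (inj₁ x′) x≢x′ same = contradiction (cong inj₁ (toℕ-injective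
    (square-residues-distinct pp 2h<p p∤a (toℕ≤pred[n] x) (toℕ≤pred[n] x′) (residue-≡⇒∣ (a * sq x) (a * sq x′) same)))) x≢x′
  collision (inj₁ x) (inj₂ y) _ same =
    toℕ x , toℕ y , toℕ<p x , toℕ<p y , subst (+ p ∣_) (rearrange (a * sq x) (b * sq y) c) (residue-≡⇒∣ (a * sq x) (c - b * sq y) same)
    where
    rearrange : ∀ X Y c → X - (c - Y) ≡ X + Y - c
    rearrange = solve-∀
  collision (inj₂ y) (inj₁ x) _ same =
    toℕ x , toℕ y , toℕ<p x , toℕ<p y , subst (+ p ∣_) (rearrange (a * sq x) (b * sq y) c) (∣m⇒∣-m (residue-≡⇒∣ (c - b * sq y) (a * sq x) same))
    where
    rearrange : ∀ X Y c → - ((c - Y) - X) ≡ X + Y - c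
    rearrange = solve-∀
  collision (inj₂ y) (inj₂ y′) y≢y′ same = contradiction (cong inj₂ (toℕ-injective (sym
    (square-residues-distinct pp 2h<p p∤b (toℕ≤pred[n] y′) (toℕ≤pred[n] y)
      (subst (+ p ∣_) (rearrange (b * sq y) (b * sq y′) c) (residue-≡⇒∣ (c - b * sq y) (c - b * sq y′) same)))))) y≢y′
    where
    rearrange : ∀ Y Y′ c → (c - Y) - (c - Y′) ≡ Y′ - Y
    rearrange = solve-∀

  use-collision : (∃₂ λ i j → i Fin.< j × value (splitAt (suc h) i) ≡ value (splitAt (suc h) j)) → Solution
  use-collision (i , j , i<j , same) = collision (splitAt (suc h) i) (splitAt (suc h) j) (splitAt-≢ i<j) same

odd⇒1+2h : ∀ {n} → ¬ 2 ℕ∣.∣ n → n ≡ suc (n / 2 ℕ.+ n / 2)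
odd⇒1+2h {n} 2∤n = begin
  n                       ≡⟨ m≡m%n+[m/n]*n n 2 ⟩
  n % 2 ℕ.+ n / 2 ℕ.* 2   ≡⟨ cong (ℕ._+ n / 2 ℕ.* 2) n%2≡1 ⟩
  suc (n / 2 ℕ.* 2)       ≡⟨ cong suc (trans (ℕ.*-comm (n / 2) 2) (cong (n / 2 ℕ.+_) (ℕ.+-identityʳ (n / 2)))) ⟩
  suc (n / 2 ℕ.+ n / 2)   ∎
  where
  n%2≡1 : n % 2 ≡ 1
  n%2≡1 with n % 2 | m%n<n n 2 | ℕ∣.m%n≡0⇒n∣m n 2
  ... | zero        | _            | 2∣n = contradiction (2∣n refl) 2∤n
  ... | suc zero    | _            | _   = refl
  ... | suc (suc _) | s≤s (s≤s ()) | _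

∤70⇒∤divisor : ∀ {p} → ¬ p ℕ∣.∣ 70 → ∀ k → k ℕ∣.∣ 70 → ¬ + p ∣ + k
∤70⇒∤divisor p∤70 k k∣70 p∣k = p∤70 (ℕ∣.∣-trans (∣⇒∣ᵤ p∣k) k∣70)

-- p cannot divide both m and m - 70.
∃z-p∤m-70z² : ∀ {p} → ¬ p ℕ∣.∣ 70 → ∀ m → ∃[ z ] ¬ + p ∣ m - + 70 * (z * z)
∃z-p∤m-70z² {p} p∤70 m with + p ∣? m
... | no p∤m  = + 0 , p∤m ∘ subst (+ p ∣_) (+-identityʳ m)
... | yes p∣m = + 1 , ∤70⇒∤divisor p∤70 70 ℕ∣.∣-refl ∘ subst (+ p ∣_) (identity m) ∘ ∣m∣n⇒∣m-n p∣m
  where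
  identity : ∀ m → m - (m - + 70) ≡ + 70
  identity = solve-∀

p∤70⇒repZp : ∀ {p} → Prime p → ¬ p ℕ∣.∣ 70 → ∀ m → RepZp p m
p∤70⇒repZp {p} pp p∤70 m = from-z (∃z-p∤m-70z² p∤70 m)
  where
  2∤p : ¬ 2 ℕ∣.∣ p
  2∤p 2∣p = p∤70 (subst (ℕ∣._∣ 70) (prime∣prime prime[2] pp 2∣p) (ℕ∣.divides 35 refl))

  p∤suc : ∀ {x} → suc x ℕ.< p → ¬ + p ∣ + suc x
  p∤suc x<p p∣x = ℕ∣.>⇒∤ x<p (∣⇒∣ᵤ p∣x)

  lift : ∀ {z} → ¬ + p ∣ m - + 70 * (z * z) → ∀ x y → x ℕ.< p → y ℕ.< p →
         + p ∣ f (+ x) (+ y) z - m → RepZp p m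
  lift {z} _ (suc x) y x<p _ p∣ = repZp-lift-x {x = + suc x} {+ y} {z} {m} pp p∣
    (prime∤* pp (∤70⇒∤divisor p∤70 10 (ℕ∣.divides 7 refl)) (p∤suc x<p))
  lift {z} _ zero (suc y) _ y<p p∣ = repZp-lift-y {x = + 0} {+ suc y} {z} {m} pp p∣
    (prime∤* pp (∤70⇒∤divisor p∤70 14 (ℕ∣.divides 5 refl)) (p∤suc y<p))
  lift {z} p∤c zero zero _ _ p∣ = contradiction (subst (+ p ∣_) (identity z m) (∣m⇒∣-m p∣)) p∤c
    where
    identity : ∀ z m → - (+ 5 * (+ 0 * + 0) + + 7 * (+ 0 * + 0) + + 70 * (z * z) - m) ≡ m - + 70 * (z * z)
    identity = solve-∀

  from-z : ∃[ z ] ¬ + p ∣ m - + 70 * (z * z) → RepZp p m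
  from-z (z , p∤c) with two-squares-mod {h = p / 2} pp (odd⇒1+2h 2∤p)
    (∤70⇒∤divisor p∤70 5 (ℕ∣.divides 14 refl)) (∤70⇒∤divisor p∤70 7 (ℕ∣.divides 10 refl)) (m - + 70 * (z * z))
  ... | x , y , x<p , y<p , p∣ = lift {z} p∤c x y x<p y<p (subst (+ p ∣_) (identity (+ x) (+ y) z m) p∣)
    where
    identity : ∀ x y z m → + 5 * (x * x) + + 7 * (y * y) - (m - + 70 * (z * z))
                         ≡ + 5 * (x * x) + + 7 * (y * y) + + 70 * (z * z) - m
    identity = solve-∀

prime∣70 : ∀ {p} → Prime p → p ℕ∣.∣ 70 → p ≡ 2 ⊎ p ≡ 5 ⊎ p ≡ 7
prime∣70 pp p∣70 with euclidsLemma 2 35 pp p∣70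
... | inj₁ p∣2 = inj₁ (prime∣prime pp prime[2] p∣2)
... | inj₂ p∣35 with euclidsLemma 5 7 pp p∣35
...   | inj₁ p∣5 = inj₂ (inj₁ (prime∣prime pp (from-yes (prime? 5)) p∣5))
...   | inj₂ p∣7 = inj₂ (inj₂ (prime∣prime pp (from-yes (prime? 7)) p∣7))

locallyRep-intro : ∀ {m} → + 0 ≤ m → RepZp 2 m → RepZp 5 m → RepZp 7 m → LocallyRep m
locallyRep-intro {m} 0≤m rep₂ rep₅ rep₇ = 0≤m , by-prime
  where
  by-prime : ∀ p → Prime p → RepZp p m
  by-prime p pp with p ℕ∣.∣? 70
  ... | no p∤70 = p∤70⇒repZp pp p∤70 m
  ... | yes p∣70 with prime∣70 pp p∣70
  ...   | inj₁ refl        = rep₂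
  ...   | inj₂ (inj₁ refl) = rep₅
  ...   | inj₂ (inj₂ refl) = rep₇

repZp₅-≡3 : ∀ {m} → + 5 ∣ m - + 3 → RepZp 5 m
repZp₅-≡3 {m} 5∣m-3 = repZp-lift-y {x = + 0} {+ 2} {+ 0} {m} (from-yes (prime? 5))
  (∣-diff-trans {a = f (+ 0) (+ 2) (+ 0)} {+ 3} {m} (divides (+ 5) refl) 5∣m-3) (from-no (+ 5 ∣? + 14 * + 2))

repZp₇-≡5 : ∀ {m} → + 7 ∣ m - + 5 → RepZp 7 m
repZp₇-≡5 {m} 7∣m-5 = repZp-lift-x {x = + 1} {+ 0} {+ 0} {m} (from-yes (prime? 7))
  (∣-diff-trans {a = f (+ 1) (+ 0) (+ 0)} {+ 5} {m} (divides (+ 0) refl) 7∣m-5) (from-no (+ 7 ∣? + 10 * + 1))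

repZp₇-≡3 : ∀ {m} → + 7 ∣ m - + 3 → RepZp 7 m
repZp₇-≡3 {m} 7∣m-3 = repZp-lift-x {x = + 3} {+ 0} {+ 0} {m} (from-yes (prime? 7))
  (∣-diff-trans {a = f (+ 3) (+ 0) (+ 0)} {+ 3} {m} (divides (+ 6) refl) 7∣m-3) (from-no (+ 7 ∣? + 10 * + 3))

70n-s≥0 : ∀ n s .{{_ : ℕ.NonZero n}} → s ℕ.≤ 70 → + 0 ≤ + 70 * + n - + s
70n-s≥0 n s s≤70 = subst (+ 0 ≤_) (sym (begin
  + 70 * + n - + s     ≡⟨ cong (_- + s) (pos-* 70 n) ⟨
  + (70 ℕ.* n) - + s   ≡⟨ m-n≡m⊖n (70 ℕ.* n) s ⟩
  70 ℕ.* n ℤ.⊖ s       ≡⟨ ⊖-≥ (ℕ.≤-trans s≤70 (ℕ.m≤m*n 70 n)) ⟩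
  + (70 ℕ.* n ℕ.∸ s)   ∎)) (+≤+ z≤n)

70n-s-mod : ∀ {d} n s r → + d ∣ + 70 → + d ∣ - s - r → + d ∣ (+ 70 * + n - s) - r
70n-s-mod n s r d∣70 d∣-s-r = subst (_ ∣_) (identity (+ n) s r) (∣m∣n⇒∣m+n (∣m⇒∣m*n (+ n) d∣70) d∣-s-r)
  where
  identity : ∀ n s r → + 70 * n + (- s - r) ≡ (+ 70 * n - s) - r
  identity = solve-∀

locallyRep-70n-2 : ∀ n .{{_ : ℕ.NonZero n}} → RepZp 2 (+ 70 * + n - + 2) → LocallyRep (+ 70 * + n - + 2)
locallyRep-70n-2 n rep₂ = locallyRep-intro (70n-s≥0 n 2 (ℕ.m≤m+n 2 68)) rep₂
  (repZp₅-≡3 (70n-s-mod n (+ 2) (+ 3) (divides (+ 14) refl) (divides (- + 1) refl)))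
  (repZp₇-≡5 (70n-s-mod n (+ 2) (+ 5) (divides (+ 10) refl) (divides (- + 1) refl)))

locallyRep-70n-32 : ∀ n .{{_ : ℕ.NonZero n}} → RepZp 2 (+ 70 * + n - + 32) → LocallyRep (+ 70 * + n - + 32)
locallyRep-70n-32 n rep₂ = locallyRep-intro (70n-s≥0 n 32 (ℕ.m≤m+n 32 38)) rep₂
  (repZp₅-≡3 (70n-s-mod n (+ 32) (+ 3) (divides (+ 14) refl) (divides (- + 7) refl)))
  (repZp₇-≡3 (70n-s-mod n (+ 32) (+ 3) (divides (+ 10) refl) (divides (- + 5) refl)))

lemma4p1 : (n : ℕ) →
    ((n % 4 ≡ 1 ⊎ n % 4 ≡ 2 ⊎ n % 8 ≡ 4) → LocallyRep (+ 70 * + n - + 2)) ×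
    ((n % 4 ≡ 3 ⊎ n % 16 ≡ 8) → LocallyRep (+ 70 * + n - + 32))
lemma4p1 zero = (λ { (inj₁ ()) ; (inj₂ (inj₁ ())) ; (inj₂ (inj₂ ())) }) , (λ { (inj₁ ()) ; (inj₂ ()) })
lemma4p1 n@(suc _) =
  (λ class → locallyRep-70n-2 n (repZp₂-70n-2 n class)) ,
  (λ class → locallyRep-70n-32 n (repZp₂-70n-32 n class))
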